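{- For all integers $a,b,c$, in $\tilde{\mathrm{CH}}_2$: \[ \tilde h_{a+b}\tilde h_c-\tilde h_b\tilde h_{a+c}=U(a,b,c),\qquad (\tilde h_{b+a}+\tilde h_{b-a})\tilde h_{c-1}-\tilde h_b\tilde h_{a+c-1}=U(b+1,a,c). \]
   Context: $\tau(i)=|i+1|-1$. $\tilde{\mathrm{CH}}_2$: the ring generated by $\tilde h_i$, $i\in\mathbb{Z}$; its elements are finite integer linear combinations of the linearly independent symbols $\tilde h_i$, with bilinear multiplication $\tilde h_{ -1}\tilde h_j=0$, $\tilde h_i\tilde h_j=\sum_{k=0}^i\tilde h_{j-i+2k}$ for $i\ge0$, and $\tilde h_i\tilde h_j=-\tilde h_{\tau(i)}\tilde h_j$ for $i<-1$. For integers $a,b,c$: $U(a,b,c)=\mathrm{sgn}(a)\sum_{j=0}^{|a|-1}\tilde h_{c-b-|a|+2j}$, with $U(0,b,c)=0$. -}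

module Defs where

open import Data.Integer using (ℤ; +_; -[1+_]; _+_; _-_; _*_; -_; ∣_∣; 0ℤ; 1ℤ; -1ℤ)
open import Data.Nat using (ℕ; zero; suc)
open import Data.List using (List; []; _∷_; _++_; map; concatMap; foldr)
open import Data.Product using (_×_; _,_; proj₁; proj₂)
open import Relation.Binary.PropositionalEquality using (_≡_)
open import Relation.Nullary.Decidable using (⌊_⌋)
import Data.Integer as Z

-- An element of CH̃₂ is a finite integer linear combination of the symbols h̃_i,
-- represented as a formal sum: a list of (coefficient , index) pairs.
CH : Set
CH = List (ℤ × ℤ)

h : ℤ → CH
h i = (1ℤ , i) ∷ []

infixl 6 _⊕_ _⊝_
infixl 7 _⊗_

_⊕_ : CH → CH → CH
x ⊕ y = x ++ y

scale : ℤ → CH → CH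
scale c = map (λ p → (c * proj₁ p , proj₂ p))

⊖_ : CH → CH
⊖ x = scale -1ℤ x

_⊝_ : CH → CH → CH
x ⊝ y = x ⊕ (⊖ y)

-- coefficient of h̃_k (symbols are linearly independent, so this determines the element)
coeff : CH → ℤ → ℤ
coeff x k = foldr (λ p acc → (if ⌊ proj₂ p Z.≟ k ⌋ then proj₁ p else 0ℤ) + acc) 0ℤ x
  where
  open import Data.Bool using (if_then_else_)

infix 4 _≈_
_≈_ : CH → CH → Set
x ≈ y = ∀ k → coeff x k ≡ coeff y k

τ : ℤ → ℤ
τ i = + ∣ i + 1ℤ ∣ - 1ℤ

run : ℕ → ℤ → CH
run zero s = []
run (suc n) s = h s ++ run n (s + + 2)

-- h̃_i h̃_j for i ≥ 0 : Σ_{k=0}^{i} h̃_{j-i+2k}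
hpos : ℕ → ℤ → CH
hpos i j = run (suc i) (j - + i)

-- product of generators h̃_i h̃_j
-- i = -1 : 0 ;  i ≥ 0 : hpos ;  i < -1 (i = -[1+ suc n ], τ(i) = n ≥ 0) : - h̃_{τ(i)} h̃_j
hh : ℤ → ℤ → CH
hh (+ i) j = hpos i j
hh -[1+ zero ] j = []
hh -[1+ suc n ] j = ⊖ (hpos n j)

_⊗_ : CH → CH → CH
x ⊗ y = concatMap (λ p → concatMap (λ q → scale (proj₁ p * proj₁ q) (hh (proj₂ p) (proj₂ q))) y) x

sgn : ℤ → ℤ
sgn (+ zero) = 0ℤ
sgn (+ suc _) = 1ℤ
sgn -[1+ _ ] = -1ℤ

U : ℤ → ℤ → ℤ → CH
U a b c = scale (sgn a) (run ∣ a ∣ (c - b - + ∣ a ∣))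

-- Every product h̃ᵢ h̃ⱼ, including those with i < 0 that are defined through τ, is a
-- "signed run" of 1 + i generators h̃_{j-i}, h̃_{j-i+2}, …, and so is U(a,b,c).
-- Signed runs are additive in their length, so both sides of each identity split into
-- runs that cancel in pairs, leaving exactly U.
module Submission where

open import Defs
open import Data.Integer using (ℤ; _+_; _-_; 1ℤ)
open import Data.Product using (_×_)

open import Data.Bool using (true; false; if_then_else_)
open import Data.Integer using (+_; -[1+_]; _*_; -_; 0ℤ; -1ℤ; _≟_)
open import Data.Integer.Properties
  using (+-0-abelianGroup; +-identityˡ; +-identityʳ; +-assoc; *-identityˡ; *-distribˡ-+; *-zeroʳ; -1*i≡-i)
open import Algebra.Properties.AbelianGroup +-0-abelianGroup using (∙-cancelʳ)
open import Data.Integer.Tactic.RingSolver using (solve-∀)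
open import Data.List using ([]; _∷_; _++_)
open import Data.List.Properties using (++-identityʳ; concatMap-++)
open import Data.Nat using (zero; suc)
open import Data.Product using (_,_)
open import Relation.Binary.PropositionalEquality
  using (_≡_; refl; sym; trans; cong; cong₂; module ≡-Reasoning)
open import Relation.Nullary.Decidable using (⌊_⌋)

open ≡-Reasoning

coeff-⊕ : ∀ x y k → coeff (x ⊕ y) k ≡ coeff x k + coeff y k
coeff-⊕ []            y k = sym (+-identityˡ (coeff y k))
coeff-⊕ ((a , i) ∷ x) y k =
  trans (cong (λ t → aₖ + t) (coeff-⊕ x y k)) (sym (+-assoc aₖ (coeff x k) (coeff y k)))
  where
  aₖ : ℤ
  aₖ = if ⌊ i ≟ k ⌋ then a else 0ℤ

coeff-scale : ∀ c x k → coeff (scale c x) k ≡ c * coeff x k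
coeff-scale c []            k = sym (*-zeroʳ c)
coeff-scale c ((a , i) ∷ x) k with ⌊ i ≟ k ⌋
... | true  = trans (cong (λ t → c * a + t) (coeff-scale c x k)) (sym (*-distribˡ-+ c a (coeff x k)))
... | false = trans (+-identityˡ _) (trans (coeff-scale c x k) (cong (c *_) (sym (+-identityˡ _))))

coeff-⊖ : ∀ x k → coeff (⊖ x) k ≡ - coeff x k
coeff-⊖ x k = trans (coeff-scale -1ℤ x k) (-1*i≡-i (coeff x k))

coeff-⊝ : ∀ x y k → coeff (x ⊝ y) k ≡ coeff x k - coeff y k
coeff-⊝ x y k = trans (coeff-⊕ x (⊖ y) k) (cong (λ t → coeff x k + t) (coeff-⊖ y k))

⊖-⊕-cancel : ∀ x y → ⊖ (x ⊕ y) ⊕ x ≈ ⊖ y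
⊖-⊕-cancel x y k = begin
  coeff (⊖ (x ⊕ y) ⊕ x) k
    ≡⟨ coeff-⊕ (⊖ (x ⊕ y)) x k ⟩
  coeff (⊖ (x ⊕ y)) k + coeff x k
    ≡⟨ cong (_+ coeff x k) (trans (coeff-⊖ (x ⊕ y) k) (cong -_ (coeff-⊕ x y k))) ⟩
  - (coeff x k + coeff y k) + coeff x k
    ≡⟨ cancel (coeff x k) (coeff y k) ⟩
  - coeff y k
    ≡⟨ coeff-⊖ y k ⟨
  coeff (⊖ y) k ∎
  where
  cancel : ∀ u v → - (u + v) + u ≡ - v
  cancel = solve-∀

scale-identity : ∀ x → scale 1ℤ x ≡ x
scale-identity []            = refl
scale-identity ((a , i) ∷ x) = cong₂ _∷_ (cong (_, i) (*-identityˡ a)) (scale-identity x)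

⊗-distribʳ-⊕ : ∀ x y z → (x ⊕ y) ⊗ z ≡ x ⊗ z ⊕ y ⊗ z
⊗-distribʳ-⊕ x y z = concatMap-++ _ x y

recurrence-unique : ∀ (δ f g : ℤ → ℤ) →
  (∀ m → f (1ℤ + m) ≡ f m + δ m) → (∀ m → g (1ℤ + m) ≡ g m + δ m) →
  f 0ℤ ≡ g 0ℤ → ∀ m → f m ≡ g m
recurrence-unique δ f g f-rec g-rec f0≡g0 = agree
  where
  forward : ∀ m → f m ≡ g m → f (1ℤ + m) ≡ g (1ℤ + m)
  forward m eq = trans (f-rec m) (trans (cong (_+ δ m) eq) (sym (g-rec m)))

  backward : ∀ m → f (1ℤ + m) ≡ g (1ℤ + m) → f m ≡ g m
  backward m eq = ∙-cancelʳ (δ m) (f m) (g m) (trans (sym (f-rec m)) (trans eq (g-rec m)))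

  -- 1ℤ + -[1+ suc n ] reduces to -[1+ n ], so the negative half is structural too.
  agree : ∀ m → f m ≡ g m
  agree (+ zero)     = f0≡g0
  agree (+ suc n)    = forward (+ n) (agree (+ n))
  agree -[1+ zero ]  = backward -[1+ zero ] f0≡g0
  agree -[1+ suc n ] = backward -[1+ suc n ] (agree -[1+ n ])

-- For m < 0 this is minus the run over h̃_{s+2m}, …, h̃_{s-2}: the convention
-- Σ_{0≤j<m} = - Σ_{m≤j<0} under which signedRun-+ holds for all integer lengths.
signedRun : ℤ → ℤ → CH
signedRun (+ n)    s = run n s
signedRun -[1+ n ] s = ⊖ run (suc n) (s + + 2 * -[1+ n ])

run-suc : ∀ n s → run (suc n) s ≡ run n s ⊕ h (s + + 2 * + n)
run-suc zero    s = cong h (sym (+-identityʳ s))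
run-suc (suc n) s =
  cong (h s ⊕_) (trans (run-suc n (s + + 2)) (cong (λ t → run n (s + + 2) ⊕ h t) (shift s (+ n))))
  where
  shift : ∀ s x → s + + 2 + + 2 * x ≡ s + + 2 * (1ℤ + x)
  shift = solve-∀

signedRun-1+ : ∀ m s → signedRun (1ℤ + m) s ≈ signedRun m s ⊕ h (s + + 2 * m)
signedRun-1+ (+ n)    s k = cong (λ x → coeff x k) (run-suc n s)
signedRun-1+ -[1+ n ] s k =
  trans (cong (λ x → coeff x k) (drop-first n)) (sym (⊖-⊕-cancel (h t) (run n (t + + 2)) k))
  where
  t : ℤ
  t = s + + 2 * -[1+ n ]

  shift : ∀ s x → s + + 2 * - (1ℤ + x) ≡ s + + 2 * - (1ℤ + (1ℤ + x)) + + 2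
  shift = solve-∀

  drop-first : ∀ n → signedRun (1ℤ + -[1+ n ]) s ≡ ⊖ run n (s + + 2 * -[1+ n ] + + 2)
  drop-first zero    = refl
  drop-first (suc q) = cong (λ u → ⊖ run (suc q) u) (shift s (+ q))

signedRun-+ : ∀ m n s → signedRun (m + n) s ≈ signedRun m s ⊕ signedRun n (s + + 2 * m)
signedRun-+ m n s k =
  trans (recurrence-unique δ f g f-rec g-rec f0≡g0 n) (sym (coeff-⊕ (signedRun m s) _ k))
  where
  R : ℤ → ℤ → ℤ
  R m s = coeff (signedRun m s) k

  R-1+ : ∀ m s → R (1ℤ + m) s ≡ R m s + coeff (h (s + + 2 * m)) k
  R-1+ m s = trans (signedRun-1+ m s k) (coeff-⊕ (signedRun m s) _ k)

  δ f g : ℤ → ℤ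
  δ n = coeff (h (s + + 2 * m + + 2 * n)) k
  f n = R (m + n) s
  g n = R m s + R n (s + + 2 * m)

  assoc-1+ : ∀ m n → m + (1ℤ + n) ≡ 1ℤ + (m + n)
  assoc-1+ = solve-∀

  distrib : ∀ s m n → s + + 2 * (m + n) ≡ s + + 2 * m + + 2 * n
  distrib = solve-∀

  f-rec : ∀ n → f (1ℤ + n) ≡ f n + δ n
  f-rec n = begin
    R (m + (1ℤ + n)) s                            ≡⟨ cong (λ p → R p s) (assoc-1+ m n) ⟩
    R (1ℤ + (m + n)) s                            ≡⟨ R-1+ (m + n) s ⟩
    R (m + n) s + coeff (h (s + + 2 * (m + n))) k ≡⟨ cong (λ u → f n + coeff (h u) k) (distrib s m n) ⟩
    f n + δ n                                     ∎

  g-rec : ∀ n → g (1ℤ + n) ≡ g n + δ n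
  g-rec n = trans (cong (λ u → R m s + u) (R-1+ n (s + + 2 * m))) (sym (+-assoc (R m s) _ _))

  f0≡g0 : f 0ℤ ≡ g 0ℤ
  f0≡g0 = trans (cong (λ p → R p s) (+-identityʳ m)) (sym (+-identityʳ (R m s)))

coeff-signedRun-split : ∀ {m n p s t} → m + n ≡ p → s + + 2 * m ≡ t → ∀ k →
  coeff (signedRun p s) k ≡ coeff (signedRun m s) k + coeff (signedRun n t) k
coeff-signedRun-split {m} {n} {s = s} refl refl k =
  trans (signedRun-+ m n s k) (coeff-⊕ (signedRun m s) _ k)

hh≡signedRun : ∀ i j → hh i j ≡ signedRun (1ℤ + i) (j - i)
hh≡signedRun (+ n)        j = refl
hh≡signedRun -[1+ zero ]  j = refl
hh≡signedRun -[1+ suc n ] j = cong (λ s → ⊖ run (suc n) s) (shift j (+ n))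
  where
  shift : ∀ j x → j - x ≡ j - - (1ℤ + (1ℤ + x)) + + 2 * - (1ℤ + x)
  shift = solve-∀

h⊗h≡signedRun : ∀ i j → h i ⊗ h j ≡ signedRun (1ℤ + i) (j - i)
h⊗h≡signedRun i j = begin
  (scale 1ℤ (hh i j) ++ []) ++ [] ≡⟨ ++-identityʳ _ ⟩
  scale 1ℤ (hh i j) ++ []         ≡⟨ ++-identityʳ _ ⟩
  scale 1ℤ (hh i j)               ≡⟨ scale-identity (hh i j) ⟩
  hh i j                          ≡⟨ hh≡signedRun i j ⟩
  signedRun (1ℤ + i) (j - i)      ∎

coeff-h⊗h : ∀ i j k → coeff (h i ⊗ h j) k ≡ coeff (signedRun (1ℤ + i) (j - i)) k
coeff-h⊗h i j k = cong (λ x → coeff x k) (h⊗h≡signedRun i j)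

U≡signedRun : ∀ a b c → U a b c ≡ signedRun a (c - b - a)
U≡signedRun (+ zero)  b c = refl
U≡signedRun (+ suc n) b c = scale-identity (run (suc n) (c - b - + suc n))
U≡signedRun -[1+ n ]  b c = cong (λ s → ⊖ run (suc n) s) (shift (c - b) (+ n))
  where
  shift : ∀ t x → t - (1ℤ + x) ≡ t - - (1ℤ + x) + + 2 * - (1ℤ + x)
  shift = solve-∀

h⊗h-exchange≈U : ∀ a b c → h (a + b) ⊗ h c ⊝ h b ⊗ h (a + c) ≈ U a b c
h⊗h-exchange≈U a b c k = begin
  coeff (h (a + b) ⊗ h c ⊝ h b ⊗ h (a + c)) k
    ≡⟨ coeff-⊝ (h (a + b) ⊗ h c) (h b ⊗ h (a + c)) k ⟩
  coeff (h (a + b) ⊗ h c) k - coeff (h b ⊗ h (a + c)) k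
    ≡⟨ cong₂ _-_ (coeff-h⊗h (a + b) c k) (coeff-h⊗h b (a + c) k) ⟩
  R (1ℤ + (a + b)) (c - (a + b)) - R (1ℤ + b) (a + c - b)
    ≡⟨ cong (λ x → x - R (1ℤ + b) (a + c - b))
            (trans (cong (R (1ℤ + (a + b))) (e₀ a b c)) (coeff-signedRun-split (e₁ a b) (e₂ a b c) k)) ⟩
  R a (c - b - a) + R (1ℤ + b) (a + c - b) - R (1ℤ + b) (a + c - b)
    ≡⟨ cancel _ _ ⟩
  R a (c - b - a)
    ≡⟨ cong (λ x → coeff x k) (U≡signedRun a b c) ⟨
  coeff (U a b c) k ∎
  where
  R : ℤ → ℤ → ℤ
  R m s = coeff (signedRun m s) k

  e₀ : ∀ a b c → c - (a + b) ≡ c - b - a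
  e₀ = solve-∀
  e₁ : ∀ a b → a + (1ℤ + b) ≡ 1ℤ + (a + b)
  e₁ = solve-∀
  e₂ : ∀ a b c → c - b - a + + 2 * a ≡ a + c - b
  e₂ = solve-∀
  cancel : ∀ x y → x + y - y ≡ x
  cancel = solve-∀

h±⊗h-exchange≈U : ∀ a b c →
  (h (b + a) ⊕ h (b - a)) ⊗ h (c - 1ℤ) ⊝ h b ⊗ h (a + c - 1ℤ) ≈ U (b + 1ℤ) a c
h±⊗h-exchange≈U a b c k = begin
  coeff ((h (b + a) ⊕ h (b - a)) ⊗ h (c - 1ℤ) ⊝ P₃) k
    ≡⟨ cong (λ x → coeff (x ⊝ P₃) k) (⊗-distribʳ-⊕ (h (b + a)) (h (b - a)) (h (c - 1ℤ))) ⟩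
  coeff (P₁ ⊕ P₂ ⊝ P₃) k
    ≡⟨ trans (coeff-⊝ (P₁ ⊕ P₂) P₃ k) (cong (λ x → x - coeff P₃ k) (coeff-⊕ P₁ P₂ k)) ⟩
  coeff P₁ k + coeff P₂ k - coeff P₃ k
    ≡⟨ cong₂ _-_ (cong₂ _+_ (coeff-h⊗h (b + a) (c - 1ℤ) k) (coeff-h⊗h (b - a) (c - 1ℤ) k))
                 (coeff-h⊗h b (a + c - 1ℤ) k) ⟩
  R (1ℤ + (b + a)) (c - 1ℤ - (b + a)) + R (1ℤ + (b - a)) s₂ - R (1ℤ + b) (a + c - 1ℤ - b)
    -- the first and third runs both end in the same run of length a, starting at t
    ≡⟨ cong₂ (λ x y → x + R (1ℤ + (b - a)) s₂ - y)
             (trans (cong (R (1ℤ + (b + a))) (e₀ a b c)) (coeff-signedRun-split (e₁ a b) (e₂ a b c) k))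
             (trans (cong (R (1ℤ + b)) (e₃ a b c)) (coeff-signedRun-split (e₄ a b) (e₅ a b c) k)) ⟩
  R (b + 1ℤ) s₁ + R a t + R (1ℤ + (b - a)) s₂ - (R (1ℤ + (b - a)) s₂ + R a t)
    ≡⟨ cancel _ _ _ ⟩
  R (b + 1ℤ) s₁
    ≡⟨ cong (λ x → coeff x k) (U≡signedRun (b + 1ℤ) a c) ⟨
  coeff (U (b + 1ℤ) a c) k ∎
  where
  R : ℤ → ℤ → ℤ
  R m s = coeff (signedRun m s) k

  P₁ P₂ P₃ : CH
  P₁ = h (b + a) ⊗ h (c - 1ℤ)
  P₂ = h (b - a) ⊗ h (c - 1ℤ)
  P₃ = h b ⊗ h (a + c - 1ℤ)

  s₁ s₂ t : ℤ
  s₁ = c - a - (b + 1ℤ)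
  s₂ = c - 1ℤ - (b - a)
  t  = c - a + b + 1ℤ

  e₀ : ∀ a b c → c - 1ℤ - (b + a) ≡ c - a - (b + 1ℤ)
  e₀ = solve-∀
  e₁ : ∀ a b → b + 1ℤ + a ≡ 1ℤ + (b + a)
  e₁ = solve-∀
  e₂ : ∀ a b c → c - a - (b + 1ℤ) + + 2 * (b + 1ℤ) ≡ c - a + b + 1ℤ
  e₂ = solve-∀
  e₃ : ∀ a b c → a + c - 1ℤ - b ≡ c - 1ℤ - (b - a)
  e₃ = solve-∀
  e₄ : ∀ a b → 1ℤ + (b - a) + a ≡ 1ℤ + b
  e₄ = solve-∀
  e₅ : ∀ a b c → c - 1ℤ - (b - a) + + 2 * (1ℤ + (b - a)) ≡ c - a + b + 1ℤ
  e₅ = solve-∀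
  cancel : ∀ x y z → x + y + z - (z + y) ≡ x
  cancel = solve-∀

lemma3p11 : ∀ (a b c : ℤ) →
    ((h (a + b) ⊗ h c ⊝ h b ⊗ h (a + c)) ≈ U a b c)
    × (((h (b + a) ⊕ h (b - a)) ⊗ h (c - 1ℤ) ⊝ h b ⊗ h (a + c - 1ℤ)) ≈ U (b + 1ℤ) a c)
lemma3p11 a b c = h⊗h-exchange≈U a b c , h±⊗h-exchange≈U a b c
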